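{- Suppose that $K>1$ satisfies $\mathrm{gcd}(K,M)=1$. Then $\Gamma_0(M)$ can be generated by $T=\begin{pmatrix} 1 & 1 \\ 0 & 1\end{pmatrix}$ and a finite set of matrices of the form \[ \begin{pmatrix} K a & b \\ M c & K d\end{pmatrix} \text{ with } a,b,c,d\in \mathbb{Z}. \]
   Context: $M$ is a positive integer and $\Gamma_0(M)\subset\mathrm{SL}_2(\mathbb{Z})$ is the subgroup of matrices whose lower-left entry is divisible by $M$. -}

module Defs where

open import Data.Integer using (ℤ; +_; _+_; _*_; _-_; -_)
open import Data.Integer.Divisibility using (_∣_)
open import Data.List using (List; _∷_)
open import Data.List.Membership.Propositional using (_∈_)
open import Relation.Binary.PropositionalEquality using (_≡_)

record Mat : Set where
  constructor mat
  field
    a b c d : ℤ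

open Mat public

_·_ : Mat → Mat → Mat
mat a₁ b₁ c₁ d₁ · mat a₂ b₂ c₂ d₂ =
  mat (a₁ * a₂ + b₁ * c₂) (a₁ * b₂ + b₁ * d₂)
      (c₁ * a₂ + d₁ * c₂) (c₁ * b₂ + d₁ * d₂)

det : Mat → ℤ
det (mat a b c d) = a * d - b * c

I₂ : Mat
I₂ = mat (+ 1) (+ 0) (+ 0) (+ 1)

-- inverse in SL₂(ℤ) (adjugate; equals the inverse when det = 1)
inv : Mat → Mat
inv (mat a b c d) = mat d (- b) (- c) a

T : Mat
T = mat (+ 1) (+ 1) (+ 0) (+ 1)

InSL2 : Mat → Set
InSL2 g = det g ≡ + 1

InΓ₀ : ℤ → Mat → Set
InΓ₀ M g = det g ≡ + 1 × (M ∣ c g)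
  where open import Data.Product using (_×_)

data Gen (S : List Mat) : Mat → Set where
  gen  : ∀ {g} → g ∈ S → Gen S g
  one  : Gen S I₂
  mul  : ∀ {g h} → Gen S g → Gen S h → Gen S (g · h)
  ginv : ∀ {g} → Gen S g → Gen S (inv g)

{-# OPTIONS --safe #-}
module Submission where

-- SL₂(ℤ) is generated by T and S (Euclid on the bottom row). Schreier's lemma,
-- with coset representatives of Γ₀(M) indexed by bottom rows modulo M, then
-- shows that Γ₀(M) is generated by finitely many matrices Y = (a b ; c d) with
-- M ∣ c. Multiplying Y on the right by a power of L = (1 0 ; M 1) makes c
-- coprime to K; then, for u inverse to c modulo K, T^(-au) Y T^(-du) has both
-- diagonal entries divisible by K. So Y lies in the group generated by T, that
-- matrix and the matrix obtained from L in the same way.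

open import Defs
open import Data.Nat as ℕ using (ℕ; zero; suc; _>_; _≥_)
import Data.Nat.Properties as ℕ
import Data.Nat.Divisibility as ℕ
import Data.Nat.Coprimality as ℕ
open import Data.Nat.GCD using (gcd; gcd[m,n]∣m; gcd[m,n]∣n; gcd[m,n]≢0; gcd-GCD; module Bézout; module GCD)
open import Data.Integer hiding (suc; _>_; _≥_)
open import Data.Integer.Properties
import Data.Integer.Coprimality as ℤ
open import Data.Integer.DivMod using (a≡a%n+[a/n]*n; a≡a%ℕn+[a/ℕn]*n; n%d<d; n%ℕd<d)
open import Data.Integer.Divisibility.Signed
open import Data.Integer.Tactic.RingSolver
open import Data.List using (List; _∷_; []; _++_; map; filter; cartesianProduct; cartesianProductWith; upTo)
open import Data.List.Membership.Propositional using (_∈_)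
open import Data.List.Membership.Propositional.Properties
  using (∈-map⁺; ∈-filter⁺; ∈-cartesianProduct⁺; ∈-cartesianProductWith⁺; ∈-upTo⁺; ∈-++⁺ˡ; ∈-++⁺ʳ)
open import Data.List.Relation.Unary.All using (All; _∷_)
import Data.List.Relation.Unary.All as All
import Data.List.Relation.Unary.All.Properties as All
open import Data.List.Relation.Unary.Any using (here; there)
open import Data.Product using (Σ; ∃; _×_; _,_; proj₁; proj₂; uncurry)
open import Data.Sum using (_⊎_; inj₁; inj₂)
open import Relation.Binary.PropositionalEquality
open import Relation.Nullary using (yes; no; contradiction)
open import Relation.Nullary.Decidable using (_×-dec_)
open import Relation.Unary using (Decidable)

-- Coprime parts

-- Dividing n by gcd n x until that gcd is 1 leaves the largest divisor of n
-- coprime to x; each division shrinks n, so n steps suffice.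
coprimePartWithFuel : ℕ → ℕ → ℕ → ℕ
coprimePartWithFuel zero    n x = n
coprimePartWithFuel (suc f) n x with gcd n x ℕ.≟ 1
... | yes _ = n
... | no  _ = coprimePartWithFuel f (ℕ.quotient (gcd[m,n]∣m n x)) x

coprimePart : ℕ → ℕ → ℕ
coprimePart n x = coprimePartWithFuel n n x

∣⇒∣coprimePartWithFuel : ∀ f {n x i} → i ℕ.∣ n → ℕ.Coprime i x → i ℕ.∣ coprimePartWithFuel f n x
∣⇒∣coprimePartWithFuel zero    i∣n _ = i∣n
∣⇒∣coprimePartWithFuel (suc f) {n} {x} {i} i∣n i⊥x with gcd n x ℕ.≟ 1
... | yes _ = i∣n
... | no  _ = ∣⇒∣coprimePartWithFuel f i∣n/gcd i⊥x
  where
  gcd∣n = gcd[m,n]∣m n x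
  i⊥gcd : ℕ.Coprime i (gcd n x)
  i⊥gcd (j∣i , j∣gcd) = i⊥x (j∣i , ℕ.∣-trans j∣gcd (gcd[m,n]∣n n x))
  i∣n/gcd : i ℕ.∣ ℕ.quotient gcd∣n
  i∣n/gcd = ℕ.coprime-divisor i⊥gcd (subst (i ℕ.∣_) (ℕ.m∣n⇒n≡m*quotient gcd∣n) i∣n)

∣⇒∣coprimePart : ∀ {n x i} → i ℕ.∣ n → ℕ.Coprime i x → i ℕ.∣ coprimePart n x
∣⇒∣coprimePart {n} = ∣⇒∣coprimePartWithFuel n

coprimePartWithFuel-coprime : ∀ f n x .{{_ : ℕ.NonZero n}} → n ℕ.≤ f → ℕ.Coprime (coprimePartWithFuel f n x) x
coprimePartWithFuel-coprime zero    (suc _) x ()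
coprimePartWithFuel-coprime (suc f) n x n≤f with gcd n x ℕ.≟ 1
... | yes gcd≡1 = ℕ.gcd≡1⇒coprime gcd≡1
... | no  gcd≢1 = coprimePartWithFuel-coprime f (ℕ.quotient gcd∣n) x {{ℕ.quotient≢0 gcd∣n}} q≤f
  where
  gcd∣n = gcd[m,n]∣m n x
  1<gcd : ∀ e → e ≢ 0 → e ≢ 1 → 1 ℕ.< e
  1<gcd zero          e≢0 _   = contradiction refl e≢0
  1<gcd (suc zero)    _   e≢1 = contradiction refl e≢1
  1<gcd (suc (suc _)) _   _   = ℕ.s≤s (ℕ.s≤s ℕ.z≤n)
  q≤f : ℕ.quotient gcd∣n ℕ.≤ f
  q≤f = ℕ.≤-pred (ℕ.≤-trans (ℕ.quotient-< gcd∣n {{ℕ.n>1⇒nonTrivial gcd>1}}) n≤f)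
    where gcd>1 = 1<gcd (gcd n x) (gcd[m,n]≢0 n x (inj₁ (ℕ.≢-nonZero⁻¹ n))) gcd≢1

coprimePart-coprime : ∀ n x .{{_ : ℕ.NonZero n}} → ℕ.Coprime (coprimePart n x) x
coprimePart-coprime n x = coprimePartWithFuel-coprime n n x ℕ.≤-refl

ℕ∣⇒∣ : ∀ {i n} → i ℕ.∣ n → + i ∣ + n
ℕ∣⇒∣ = ∣ᵤ⇒∣

pos-+-* : ∀ a b c → + (a ℕ.+ b ℕ.* c) ≡ + a + + b * + c
pos-+-* a b c = trans (pos-+ a (b ℕ.* c)) (cong (_+_ (+ a)) (pos-* b c))

∣%ℕ⇒∣ : ∀ {i n} x .{{_ : ℕ.NonZero n}} → i ℕ.∣ n → i ℕ.∣ x %ℕ n → + i ∣ x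
∣%ℕ⇒∣ {i} {n} x i∣n i∣r =
  subst (+ i ∣_) (sym (a≡a%ℕn+[a/ℕn]*n x n))
        (∣m∣n⇒∣m+n (ℕ∣⇒∣ i∣r) (∣n⇒∣m*n (x /ℕ n) (ℕ∣⇒∣ i∣n)))

-- A common divisor i of n and x + k y, where k = coprimePart n ∣x∣: the part
-- gcd i ∣x∣ divides k y and is coprime to k, so it divides y and is 1; then i
-- divides k, hence x, hence i = 1.
coprime-+-coprimePart* : ∀ n x y .{{_ : ℕ.NonZero n}} →
  (∀ {i} → i ℕ.∣ n → + i ∣ x → + i ∣ y → i ≡ 1) → ℤ.Coprime (+ n) (x + + coprimePart n ∣ x ∣ * y)
coprime-+-coprimePart* n x y common≡1 {i} (i∣n , i∣∣z∣) = i⊥x (ℕ.∣-refl , ∣⇒∣ᵤ i∣x)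
  where
  k = coprimePart n ∣ x ∣
  e = gcd i ∣ x ∣
  i∣z : + i ∣ x + + k * y
  i∣z = ∣ᵤ⇒∣ i∣∣z∣
  e∣i : e ℕ.∣ i
  e∣i = gcd[m,n]∣m i ∣ x ∣
  e∣x : + e ∣ x
  e∣x = ∣ᵤ⇒∣ (gcd[m,n]∣n i ∣ x ∣)
  e⊥k : ℕ.Coprime e k
  e⊥k (j∣e , j∣k) = coprimePart-coprime n ∣ x ∣ (j∣k , ℕ.∣-trans j∣e (gcd[m,n]∣n i ∣ x ∣))
  e∣ky : + e ∣ + k * y
  e∣ky = ∣m+n∣m⇒∣n (∣-trans (ℕ∣⇒∣ e∣i) i∣z) e∣x
  e∣y : + e ∣ y
  e∣y = ∣ᵤ⇒∣ (ℤ.coprime-divisor (+ e) (+ k) y e⊥k (∣⇒∣ᵤ e∣ky))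
  i⊥x : ℕ.Coprime i ∣ x ∣
  i⊥x = ℕ.gcd≡1⇒coprime (common≡1 (ℕ.∣-trans e∣i i∣n) e∣x e∣y)
  i∣x : + i ∣ x
  i∣x = ∣m+n∣n⇒∣m i∣z (∣m⇒∣m*n y (ℕ∣⇒∣ (∣⇒∣coprimePart i∣n i⊥x)))

bézout : ℕ → ℕ → ℤ × ℤ
bézout m n with Bézout.lemma m n
... | Bézout.result _ _ (Bézout.+- x y _) = + x , + y
... | Bézout.result _ _ (Bézout.-+ x y _) = - + x , - + y

pos-identity : ∀ d y n x m → d ℕ.+ y ℕ.* n ≡ x ℕ.* m → + d + + y * + n ≡ + x * + m
pos-identity d y n x m eq = trans (sym (pos-+-* d y n)) (trans (cong +_ eq) (pos-* x m))

bézout-identity : ∀ m n → proj₁ (bézout m n) * + m - proj₂ (bézout m n) * + n ≡ + gcd m n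
bézout-identity m n with Bézout.lemma m n
... | Bézout.result d g (Bézout.+- x y eq) rewrite GCD.unique g (gcd-GCD m n) = begin
  + x * + m - + y * + n               ≡⟨ cong (_- + y * + n) (pos-identity (gcd m n) y n x m eq) ⟨
  (+ gcd m n + + y * + n) - + y * + n ≡⟨ cancel (+ gcd m n) (+ y * + n) ⟩
  + gcd m n                           ∎
  where
  open ≡-Reasoning
  cancel : ∀ d t → (d + t) - t ≡ d
  cancel = solve-∀
... | Bézout.result d g (Bézout.-+ x y eq) rewrite GCD.unique g (gcd-GCD m n) = begin
  - + x * + m - - + y * + n           ≡⟨ negate (+ x) (+ m) (+ y) (+ n) ⟩
  + y * + n - + x * + m               ≡⟨ cong (_- + x * + m) (pos-identity (gcd m n) x m y n eq) ⟨
  (+ gcd m n + + x * + m) - + x * + m ≡⟨ cancel (+ gcd m n) (+ x * + m) ⟩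
  + gcd m n                           ∎
  where
  open ≡-Reasoning
  negate : ∀ x m y n → (- x) * m - (- y) * n ≡ y * n - x * m
  negate = solve-∀
  cancel : ∀ d t → (d + t) - t ≡ d
  cancel = solve-∀

invMod : (K : ℕ) .{{_ : ℕ.NonZero K}} → ℤ → ℤ
invMod K x = proj₁ (bézout (x %ℕ K) K)

invMod-inverse : ∀ K .{{_ : ℕ.NonZero K}} x → ℤ.Coprime (+ K) x → ∃ λ t → invMod K x * x ≡ + 1 + + K * t
invMod-inverse K x K⊥x = v + u * q , (begin
  u * x                                   ≡⟨ cong (u *_) (a≡a%ℕn+[a/ℕn]*n x K) ⟩
  u * (+ r + q * + K)                     ≡⟨ regroup u (+ r) q (+ K) v ⟩
  (u * + r - v * + K) + + K * (v + u * q) ≡⟨ cong (_+ + K * (v + u * q)) (bézout-identity r K) ⟩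
  + gcd r K + + K * (v + u * q)           ≡⟨ cong (λ g → + g + + K * (v + u * q)) (ℕ.coprime⇒gcd≡1 r⊥K) ⟩
  + 1 + + K * (v + u * q)                 ∎)
  where
  open ≡-Reasoning
  r = x %ℕ K
  q = x /ℕ K
  u = proj₁ (bézout r K)
  v = proj₂ (bézout r K)
  r⊥K : ℕ.Coprime r K
  r⊥K (i∣r , i∣K) = K⊥x (i∣K , ∣⇒∣ᵤ (∣%ℕ⇒∣ x i∣K i∣r))
  regroup : ∀ u r q K v → u * (r + q * K) ≡ (u * r - v * K) + K * (v + u * q)
  regroup = solve-∀

mat-cong : ∀ {a b c d a′ b′ c′ d′} → a ≡ a′ → b ≡ b′ → c ≡ c′ → d ≡ d′ →
           mat a b c d ≡ mat a′ b′ c′ d′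
mat-cong refl refl refl refl = refl

·-assoc : ∀ g h k → (g · h) · k ≡ g · (h · k)
·-assoc (mat a b c d) (mat e f g h) (mat i j k l) =
  mat-cong (entry a b e f g h i k) (entry a b e f g h j l) (entry c d e f g h i k) (entry c d e f g h j l)
  where
  entry : ∀ x y e f g h z w → (x * e + y * g) * z + (x * f + y * h) * w ≡ x * (e * z + f * w) + y * (g * z + h * w)
  entry = solve-∀

·-identityˡ : ∀ g → I₂ · g ≡ g
·-identityˡ (mat a b c d) = mat-cong (entry₁ a c) (entry₁ b d) (entry₂ a c) (entry₂ b d)
  where
  entry₁ : ∀ x y → + 1 * x + + 0 * y ≡ x
  entry₁ = solve-∀
  entry₂ : ∀ x y → + 0 * x + + 1 * y ≡ y
  entry₂ = solve-∀

·-identityʳ : ∀ g → g · I₂ ≡ g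
·-identityʳ (mat a b c d) = mat-cong (entry₁ a b) (entry₂ a b) (entry₁ c d) (entry₂ c d)
  where
  entry₁ : ∀ x y → x * + 1 + y * + 0 ≡ x
  entry₁ = solve-∀
  entry₂ : ∀ x y → x * + 0 + y * + 1 ≡ y
  entry₂ = solve-∀

det-· : ∀ g h → det (g · h) ≡ det g * det h
det-· (mat a b c d) (mat e f g h) = identity a b c d e f g h
  where
  identity : ∀ a b c d e f g h →
    (a * e + b * g) * (c * f + d * h) - (a * f + b * h) * (c * e + d * g) ≡ (a * d - b * c) * (e * h - f * g)
  identity = solve-∀

det-inv : ∀ g → det (inv g) ≡ det g
det-inv (mat a b c d) = identity a b c d
  where
  identity : ∀ a b c d → d * a - (- b) * (- c) ≡ a * d - b * c
  identity = solve-∀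

det-·≡1 : ∀ g h → det g ≡ + 1 → det h ≡ + 1 → det (g · h) ≡ + 1
det-·≡1 g h det-g det-h = trans (det-· g h) (cong₂ _*_ det-g det-h)

det-inv≡1 : ∀ g → det g ≡ + 1 → det (inv g) ≡ + 1
det-inv≡1 g = trans (det-inv g)

inv-inverseˡ : ∀ g → det g ≡ + 1 → inv g · g ≡ I₂
inv-inverseˡ (mat a b c d) det≡1 =
  mat-cong (trans (entry₁ a b c d) det≡1) (entry₂ b d) (entry₃ c a) (trans (entry₄ a b c d) det≡1)
  where
  entry₁ : ∀ a b c d → d * a + (- b) * c ≡ a * d - b * c
  entry₁ = solve-∀
  entry₂ : ∀ b d → d * b + (- b) * d ≡ + 0
  entry₂ = solve-∀
  entry₃ : ∀ c a → (- c) * a + a * c ≡ + 0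
  entry₃ = solve-∀
  entry₄ : ∀ a b c d → (- c) * b + a * d ≡ a * d - b * c
  entry₄ = solve-∀

·-inv-cancel : ∀ g X → det X ≡ + 1 → (g · inv X) · X ≡ g
·-inv-cancel g X det≡1 = trans (·-assoc g (inv X) X) (trans (cong (g ·_) (inv-inverseˡ X det≡1)) (·-identityʳ g))

·-inv-telescope : ∀ g R X R′ → det R ≡ + 1 → (g · inv R) · ((R · X) · inv R′) ≡ (g · X) · inv R′
·-inv-telescope g R X R′ det-R = begin
  (g · inv R) · ((R · X) · inv R′) ≡⟨ ·-assoc (g · inv R) (R · X) (inv R′) ⟨
  ((g · inv R) · (R · X)) · inv R′ ≡⟨ cong (_· inv R′) (·-assoc (g · inv R) R X) ⟨
  (((g · inv R) · R) · X) · inv R′ ≡⟨ cong (λ h → (h · X) · inv R′) (·-inv-cancel g R det-R) ⟩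
  (g · X) · inv R′                 ∎
  where open ≡-Reasoning

bottomRow-coprime : ∀ g {i} → det g ≡ + 1 → + i ∣ c g → + i ∣ d g → i ≡ 1
bottomRow-coprime (mat a b c d) det≡1 i∣c i∣d =
  ℕ.∣1⇒≡1 (∣⇒∣ᵤ (subst (_ ∣_) det≡1 (∣m∣n⇒∣m-n (∣n⇒∣m*n a i∣d) (∣n⇒∣m*n b i∣c))))

upper : ℤ → Mat
upper x = mat (+ 1) x (+ 0) (+ 1)

lower : ℤ → Mat
lower x = mat (+ 1) (+ 0) x (+ 1)

S : Mat
S = mat (+ 0) (- + 1) (+ 1) (+ 0)

det-upper : ∀ x → det (upper x) ≡ + 1
det-upper x = identity x
  where
  identity : ∀ x → + 1 * + 1 - x * + 0 ≡ + 1
  identity = solve-∀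

det-lower : ∀ x → det (lower x) ≡ + 1
det-lower x = identity x
  where
  identity : ∀ x → + 1 * + 1 - + 0 * x ≡ + 1
  identity = solve-∀

upper-+ : ∀ x y → upper x · upper y ≡ upper (x + y)
upper-+ x y = mat-cong (entry₁ x) (entry₂ x y) refl (entry₃ y)
  where
  entry₁ : ∀ x → + 1 * + 1 + x * + 0 ≡ + 1
  entry₁ = solve-∀
  entry₂ : ∀ x y → + 1 * y + x * + 1 ≡ x + y
  entry₂ = solve-∀
  entry₃ : ∀ y → + 0 * y + + 1 * + 1 ≡ + 1
  entry₃ = solve-∀

lower-+ : ∀ x y → lower x · lower y ≡ lower (x + y)
lower-+ x y = mat-cong (entry₁ y) refl (entry₂ x y) (entry₃ x)
  where
  entry₁ : ∀ y → + 1 * + 1 + + 0 * y ≡ + 1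
  entry₁ = solve-∀
  entry₂ : ∀ x y → x * + 1 + + 1 * y ≡ x + y
  entry₂ = solve-∀
  entry₃ : ∀ x → x * + 0 + + 1 * + 1 ≡ + 1
  entry₃ = solve-∀

·-upper-+ : ∀ g x y → (g · upper x) · upper y ≡ g · upper (x + y)
·-upper-+ g x y = trans (·-assoc g (upper x) (upper y)) (cong (g ·_) (upper-+ x y))

·-upper-cancel : ∀ g x y → x + y ≡ + 0 → (g · upper x) · upper y ≡ g
·-upper-cancel g x y x+y≡0 = trans (·-upper-+ g x y) (trans (cong (λ z → g · upper z) x+y≡0) (·-identityʳ g))

·-lower-cancel : ∀ g x y → x + y ≡ + 0 → (g · lower x) · lower y ≡ g
·-lower-cancel g x y x+y≡0 =
  trans (·-assoc g (lower x) (lower y)) (trans (cong (g ·_) (trans (lower-+ x y) (cong lower x+y≡0))) (·-identityʳ g))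

c-·lower : ∀ g x → c (g · lower x) ≡ c g + d g * x
c-·lower (mat a b c d) x = entry c d x
  where
  entry : ∀ c d x → c * + 1 + d * x ≡ c + d * x
  entry = solve-∀

module _ {gens : List Mat} where

  Gen-power : (P : ℤ → Mat) → P (+ 0) ≡ I₂ → (∀ x y → P x · P y ≡ P (x + y)) →
              inv (P (+ 1)) ≡ P (- + 1) → Gen gens (P (+ 1)) → ∀ z → Gen gens (P z)
  Gen-power P P0≡I P-+ P-inv P1 = power
    where
    P-1 : Gen gens (P (- + 1))
    P-1 = subst (Gen gens) P-inv (ginv P1)
    power : ∀ z → Gen gens (P z)
    power (+ zero)     = subst (Gen gens) (sym P0≡I) one
    power (+ suc n)    = subst (Gen gens) (trans (P-+ (+ n) (+ 1)) (cong (λ k → P (+ k)) (ℕ.+-comm n 1)))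
                           (mul (power (+ n)) P1)
    power -[1+ zero ]  = P-1
    power -[1+ suc n ] = subst (Gen gens) (trans (P-+ -[1+ n ] (- + 1)) (cong (λ k → P -[1+ suc k ]) (ℕ.+-identityʳ n)))
                           (mul (power -[1+ n ]) P-1)

  Gen-upper : Gen gens T → ∀ z → Gen gens (upper z)
  Gen-upper genT = Gen-power upper refl upper-+ refl genT

  Gen-lower : ∀ m → Gen gens (lower m) → ∀ z → Gen gens (lower (m * z))
  Gen-lower m genL =
    Gen-power (λ z → lower (m * z)) (cong lower (*-zeroʳ m)) lower-m-+ (cong lower (neg-distribʳ-* m (+ 1)))
              (subst (Gen gens) (cong lower (sym (*-identityʳ m))) genL)
    where
    lower-m-+ : ∀ x y → lower (m * x) · lower (m * y) ≡ lower (m * (x + y))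
    lower-m-+ x y = trans (lower-+ (m * x) (m * y)) (cong lower (sym (*-distribˡ-+ m x y)))

-- SL₂(ℤ) is generated by T and S

*≡1⇒±1 : ∀ a d → a * d ≡ + 1 → (a ≡ + 1 × d ≡ + 1) ⊎ (a ≡ - + 1 × d ≡ - + 1)
*≡1⇒±1 (+ zero)        d ()
*≡1⇒±1 (+ suc zero)    d ad≡1 = inj₁ (refl , trans (sym (*-identityˡ d)) ad≡1)
*≡1⇒±1 (+ suc (suc k)) d ad≡1
  with () ← ℕ.m*n≡1⇒m≡1 (suc (suc k)) ∣ d ∣ (trans (sym (abs-* (+ suc (suc k)) d)) (cong ∣_∣ ad≡1))
*≡1⇒±1 -[1+ zero ]     d ad≡1 = inj₂ (refl , trans (sym (neg-involutive d)) (cong -_ (trans (sym (-1*i≡-i d)) ad≡1)))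
*≡1⇒±1 -[1+ suc k ]    d ad≡1
  with () ← ℕ.m*n≡1⇒m≡1 (suc (suc k)) ∣ d ∣ (trans (sym (abs-* -[1+ suc k ] d)) (cong ∣_∣ ad≡1))

det-upperTriangular : ∀ a b d → det (mat a b (+ 0) d) ≡ a * d
det-upperTriangular a b d = identity a b d
  where
  identity : ∀ a b d → a * d - b * + 0 ≡ a * d
  identity = solve-∀

-- One Euclidean step on the bottom row: (c, d) becomes (-(d mod c), c).
reduce : (g : Mat) .{{_ : NonZero (c g)}} → Mat
reduce g = (g · upper (- (d g / c g))) · inv S

c-reduce : ∀ g .{{_ : NonZero (c g)}} → c (reduce g) ≡ - + (d g % c g)
c-reduce (mat a b C d) = begin
  (C * + 1 + d * + 0) * + 0 + (C * - q + d * + 1) * - + 1 ≡⟨ entry C d q ⟩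
  - (d - q * C)                                           ≡⟨ cong (λ z → - (z - q * C)) (a≡a%n+[a/n]*n d C) ⟩
  - (+ (d % C) + q * C - q * C)                           ≡⟨ cong -_ (cancel (+ (d % C)) (q * C)) ⟩
  - + (d % C)                                             ∎
  where
  open ≡-Reasoning
  q = d / C
  entry : ∀ C d q → (C * + 1 + d * + 0) * + 0 + (C * - q + d * + 1) * - + 1 ≡ - (d - q * C)
  entry = solve-∀
  cancel : ∀ r s → r + s - s ≡ r
  cancel = solve-∀

∣c-reduce∣<∣c∣ : ∀ g .{{_ : NonZero (c g)}} → ∣ c (reduce g) ∣ ℕ.< ∣ c g ∣
∣c-reduce∣<∣c∣ g =
  subst (ℕ._< ∣ c g ∣) (sym (trans (cong ∣_∣ (c-reduce g)) (∣-i∣≡∣i∣ (+ (d g % c g))))) (n%d<d (d g) (c g))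

reduce-·-S-upper : ∀ g .{{_ : NonZero (c g)}} → (reduce g · S) · upper (d g / c g) ≡ g
reduce-·-S-upper g = trans (cong (_· upper q) (·-inv-cancel (g · upper (- q)) S refl))
                           (·-upper-cancel g (- q) q (+-inverseˡ q))
  where q = d g / c g

SL₂-generators : List Mat
SL₂-generators = T ∷ inv T ∷ S ∷ []

det-SL₂-generator : ∀ {X} → X ∈ SL₂-generators → det X ≡ + 1
det-SL₂-generator (here refl)                 = refl
det-SL₂-generator (there (here refl))         = refl
det-SL₂-generator (there (there (here refl))) = refl

module _ (P : Mat → Set) (P-I₂ : P I₂)
         (P-step : ∀ g {X} → X ∈ SL₂-generators → det g ≡ + 1 → P g → P (g · X)) where

  private
    S∈ : S ∈ SL₂-generators
    S∈ = there (there (here refl))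

    P-·upper : ∀ g → det g ≡ + 1 → P g → ∀ z → P (g · upper z)
    P-·upper g det≡1 Pg = go
      where
      det-·upper : ∀ z → det (g · upper z) ≡ + 1
      det-·upper z = det-·≡1 g (upper z) det≡1 (det-upper z)
      go : ∀ z → P (g · upper z)
      go (+ zero)     = subst P (sym (·-identityʳ g)) Pg
      go (+ suc n)    = subst P (trans (·-upper-+ g (+ n) (+ 1)) (cong (λ k → g · upper (+ k)) (ℕ.+-comm n 1)))
                          (P-step (g · upper (+ n)) (here refl) (det-·upper (+ n)) (go (+ n)))
      go -[1+ zero ]  = P-step g (there (here refl)) det≡1 Pg
      go -[1+ suc n ] = subst P (trans (·-upper-+ g -[1+ n ] (- + 1))
                                       (cong (λ k → g · upper -[1+ suc k ]) (ℕ.+-identityʳ n)))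
                          (P-step (g · upper -[1+ n ]) (there (here refl)) (det-·upper -[1+ n ]) (go -[1+ n ]))

    P-upperTriangular : ∀ a b d → det (mat a b (+ 0) d) ≡ + 1 → P (mat a b (+ 0) d)
    P-upperTriangular a b d det≡1 with *≡1⇒±1 a d (trans (sym (det-upperTriangular a b d)) det≡1)
    ... | inj₁ (refl , refl) = subst P (·-identityˡ (upper b)) (P-·upper I₂ refl P-I₂ b)
    ... | inj₂ (refl , refl) = subst P (mat-cong refl (entry b) refl refl) (P-·upper ((I₂ · S) · S) refl P-S² (- b))
      where
      P-S² : P ((I₂ · S) · S)
      P-S² = P-step (I₂ · S) S∈ refl (P-step I₂ S∈ refl P-I₂)
      entry : ∀ b → (- + 1) * (- b) + + 0 * + 1 ≡ b
      entry = solve-∀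

    P-reduce : ∀ n g .{{_ : NonZero (c g)}} → ∣ c g ∣ ℕ.< suc n → det g ≡ + 1 →
               (∀ h → ∣ c h ∣ ℕ.< n → det h ≡ + 1 → P h) → P g
    P-reduce n g ∣c∣≤n det≡1 IH =
      subst P (reduce-·-S-upper g)
        (P-·upper (reduce g · S) (det-·≡1 (reduce g) S det-reduce refl) (P-step (reduce g) S∈ det-reduce P-reduce-g) q)
      where
      q = d g / c g
      det-reduce : det (reduce g) ≡ + 1
      det-reduce = det-·≡1 (g · upper (- q)) (inv S) (det-·≡1 g (upper (- q)) det≡1 (det-upper (- q))) refl
      P-reduce-g : P (reduce g)
      P-reduce-g = IH (reduce g) (ℕ.<-≤-trans (∣c-reduce∣<∣c∣ g) (ℕ.≤-pred ∣c∣≤n)) det-reduce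

    P-descent : ∀ n g → ∣ c g ∣ ℕ.< n → det g ≡ + 1 → P g
    P-descent zero    g                        ()     _
    P-descent (suc n) (mat a b (+ zero) d)     _      det≡1 = P-upperTriangular a b d det≡1
    P-descent (suc n) g@(mat _ _ +[1+ _ ] _) ∣c∣<n det≡1 = P-reduce n g ∣c∣<n det≡1 (P-descent n)
    P-descent (suc n) g@(mat _ _ -[1+ _ ] _) ∣c∣<n det≡1 = P-reduce n g ∣c∣<n det≡1 (P-descent n)

  SL₂-induction : ∀ g → det g ≡ + 1 → P g
  SL₂-induction g = P-descent (suc ∣ c g ∣) g ℕ.≤-refl

-- Schreier generators of Γ₀(M)

record SameBottomRowMod (m : ℤ) (g h : Mat) : Set where
  constructor _,_
  field
    ∣c-c : m ∣ c g - c h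
    ∣d-d : m ∣ d g - d h

sameBottomRow-sym : ∀ {m g h} → SameBottomRowMod m g h → SameBottomRowMod m h g
sameBottomRow-sym {m} {g} {h} (m∣c , m∣d) = swap (c g) (c h) m∣c , swap (d g) (d h) m∣d
  where
  swap : ∀ x y → m ∣ x - y → m ∣ y - x
  swap x y m∣x-y = subst (m ∣_) (neg-minus x y) (∣m⇒∣-m m∣x-y)
    where
    neg-minus : ∀ x y → - (x - y) ≡ y - x
    neg-minus = solve-∀

sameBottomRow-trans : ∀ {m g h k} → SameBottomRowMod m g h → SameBottomRowMod m h k → SameBottomRowMod m g k
sameBottomRow-trans {m} {g} {h} {k} (m∣c₁ , m∣d₁) (m∣c₂ , m∣d₂) =
  subst (m ∣_) (telescope (c g) (c h) (c k)) (∣m∣n⇒∣m+n m∣c₁ m∣c₂) ,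
  subst (m ∣_) (telescope (d g) (d h) (d k)) (∣m∣n⇒∣m+n m∣d₁ m∣d₂)
  where
  telescope : ∀ x y z → (x - y) + (y - z) ≡ x - z
  telescope = solve-∀

sameBottomRow-·ʳ : ∀ {m g h} X → SameBottomRowMod m g h → SameBottomRowMod m (g · X) (h · X)
sameBottomRow-·ʳ {m} {g} {h} X (m∣c , m∣d) = column (a X) (c X) , column (b X) (d X)
  where
  column : ∀ x y → m ∣ (c g * x + d g * y) - (c h * x + d h * y)
  column x y = subst (m ∣_) (sym (entry (c g) (d g) (c h) (d h) x y))
                      (∣m∣n⇒∣m+n (∣m⇒∣m*n x m∣c) (∣m⇒∣m*n y m∣d))
    where
    entry : ∀ p q r s x y → (p * x + q * y) - (r * x + s * y) ≡ (p - r) * x + (q - s) * y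
    entry = solve-∀

-- The lower-left entry of g · inv h is the determinant of the two bottom rows.
sameBottomRow⇒∣c·inv : ∀ {m g h} → SameBottomRowMod m g h → m ∣ c (g · inv h)
sameBottomRow⇒∣c·inv {m} {g} {h} (m∣c , m∣d) =
  subst (m ∣_) (sym (entry (c g) (d g) (c h) (d h))) (∣m∣n⇒∣m-n (∣m⇒∣m*n (d h) m∣c) (∣m⇒∣m*n (c h) m∣d))
  where
  entry : ∀ p q r s → p * s + q * (- r) ≡ (p - r) * s - (q - s) * r
  entry = solve-∀

sameBottomRow⇒∣c : ∀ {m g h} → SameBottomRowMod m g h → m ∣ c h → m ∣ c g
sameBottomRow⇒∣c {m} {g} {h} (m∣c , _) m∣ch = subst (m ∣_) (entry (c g) (c h)) (∣m∣n⇒∣m+n m∣c m∣ch)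
  where
  entry : ∀ x y → (x - y) + y ≡ x
  entry = solve-∀

module CosetRepresentatives (M : ℕ) .{{_ : ℕ.NonZero M}} where

  repC : ℕ → ℕ
  repC u = M ℕ.+ u

  instance
    repC-nonZero : ∀ {u} → ℕ.NonZero (repC u)
    repC-nonZero {u} = ℕ.>-nonZero (ℕ.<-≤-trans (ℕ.>-nonZero⁻¹ M) (ℕ.m≤m+n M u))

  repD : ℕ → ℕ → ℕ
  repD u v = v ℕ.+ coprimePart (repC u) v ℕ.* M

  -- The bottom row (M + u, v + k M) is congruent to (u, v) modulo M, and k is
  -- chosen to make it coprime whenever some coprime row is congruent to (u, v).
  rep : ℕ → ℕ → Mat
  rep u v = mat (proj₁ (bézout (repD u v) (repC u))) (proj₂ (bézout (repD u v) (repC u))) (+ repC u) (+ repD u v)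

  Rep : Mat → Mat
  Rep g = rep (c g %ℕ M) (d g %ℕ M)

  representatives : List Mat
  representatives = map (uncurry rep) (cartesianProduct (upTo M) (upTo M))

  Rep∈representatives : ∀ g → Rep g ∈ representatives
  Rep∈representatives g =
    ∈-map⁺ (uncurry rep) (∈-cartesianProduct⁺ (∈-upTo⁺ (n%ℕd<d (c g) M)) (∈-upTo⁺ (n%ℕd<d (d g) M)))

  Rep-sameBottomRow : ∀ g → SameBottomRowMod (+ M) (Rep g) g
  Rep-sameBottomRow g = divides (+ 1 - qc) c-eq , divides (+ k - qd) d-eq
    where
    u = c g %ℕ M
    v = d g %ℕ M
    k = coprimePart (repC u) v
    qc = c g /ℕ M
    qd = d g /ℕ M
    entry₁ : ∀ m u q → (m + u) - (u + q * m) ≡ (+ 1 - q) * m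
    entry₁ = solve-∀
    entry₂ : ∀ m v k q → (v + k * m) - (v + q * m) ≡ (k - q) * m
    entry₂ = solve-∀
    c-eq : + repC u - c g ≡ (+ 1 - qc) * + M
    c-eq = trans (cong₂ _-_ (pos-+ M u) (a≡a%ℕn+[a/ℕn]*n (c g) M)) (entry₁ (+ M) (+ u) qc)
    d-eq : + repD u v - d g ≡ (+ k - qd) * + M
    d-eq = trans (cong₂ _-_ (pos-+-* v k M) (a≡a%ℕn+[a/ℕn]*n (d g) M)) (entry₂ (+ M) (+ v) (+ k) qd)

  det-Rep : ∀ g → det g ≡ + 1 → det (Rep g) ≡ + 1
  det-Rep g det≡1 = trans (bézout-identity (repD u v) (repC u)) (cong +_ (ℕ.coprime⇒gcd≡1 (ℕ.sym repC⊥repD)))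
    where
    u = c g %ℕ M
    v = d g %ℕ M
    common≡1 : ∀ {i} → i ℕ.∣ repC u → + i ∣ + v → + i ∣ + M → i ≡ 1
    common≡1 i∣M+u i∣v i∣M = bottomRow-coprime g det≡1
      (∣%ℕ⇒∣ (c g) (∣⇒∣ᵤ i∣M) (ℕ.∣m+n∣m⇒∣n i∣M+u (∣⇒∣ᵤ i∣M)))
      (∣%ℕ⇒∣ (d g) (∣⇒∣ᵤ i∣M) (∣⇒∣ᵤ i∣v))
    repC⊥repD : ℕ.Coprime (repC u) (repD u v)
    repC⊥repD = subst (λ z → ℕ.Coprime (repC u) ∣ z ∣) (sym (pos-+-* v (coprimePart (repC u) v) M))
                      (coprime-+-coprimePart* (repC u) (+ v) (+ M) common≡1)

module Schreier (M : ℕ) .{{_ : ℕ.NonZero M}} where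
  open CosetRepresentatives M

  schreierGenerator : Mat → Mat × Mat → Mat
  schreierGenerator R (X , R′) = (R · X) · inv R′

  schreierGenerators : List Mat
  schreierGenerators = representatives ++
    cartesianProductWith schreierGenerator representatives (cartesianProduct SL₂-generators representatives)

  module _ (gens : List Mat)
           (gen-schreier : ∀ {Y} → Y ∈ schreierGenerators → InΓ₀ (+ M) Y → Gen gens Y) where

    private
      gen-Rep : ∀ g → det g ≡ + 1 → + M ∣ c g → Gen gens (Rep g)
      gen-Rep g det≡1 M∣c = gen-schreier (∈-++⁺ˡ (Rep∈representatives g))
                              (det-Rep g det≡1 , ∣⇒∣ᵤ (sameBottomRow⇒∣c (Rep-sameBottomRow g) M∣c))

      P : Mat → Set
      P g = Gen gens (g · inv (Rep g))

      P-I₂ : P I₂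
      P-I₂ = subst (Gen gens) (sym (·-identityˡ (inv (Rep I₂)))) (ginv (gen-Rep I₂ refl (divides (+ 0) refl)))

      P-step : ∀ g {X} → X ∈ SL₂-generators → det g ≡ + 1 → P g → P (g · X)
      P-step g {X} X∈ det≡1 Pg = subst (Gen gens) (·-inv-telescope g (Rep g) X (Rep (g · X)) (det-Rep g det≡1))
                                   (mul Pg (gen-schreier Y∈ (det-Y , ∣⇒∣ᵤ M∣cY)))
        where
        Y = schreierGenerator (Rep g) (X , Rep (g · X))
        Y∈ : Y ∈ schreierGenerators
        Y∈ = ∈-++⁺ʳ representatives (∈-cartesianProductWith⁺ schreierGenerator (Rep∈representatives g)
               (∈-cartesianProduct⁺ X∈ (Rep∈representatives (g · X))))
        det-gX : det (g · X) ≡ + 1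
        det-gX = det-·≡1 g X det≡1 (det-SL₂-generator X∈)
        det-Y : det Y ≡ + 1
        det-Y = det-·≡1 (Rep g · X) (inv (Rep (g · X))) (det-·≡1 (Rep g) X (det-Rep g det≡1) (det-SL₂-generator X∈))
                  (det-inv≡1 (Rep (g · X)) (det-Rep (g · X) det-gX))
        M∣cY : + M ∣ c Y
        M∣cY = sameBottomRow⇒∣c·inv (sameBottomRow-trans (sameBottomRow-·ʳ X (Rep-sameBottomRow g))
                                                        (sameBottomRow-sym (Rep-sameBottomRow (g · X))))

    Γ₀-generated : ∀ γ → InΓ₀ (+ M) γ → Gen gens γ
    Γ₀-generated γ (det≡1 , M∣c) = subst (Gen gens) (·-inv-cancel γ (Rep γ) (det-Rep γ det≡1))
                                     (mul (SL₂-induction P P-I₂ P-step γ det≡1) (gen-Rep γ det≡1 (∣ᵤ⇒∣ M∣c)))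

-- Matrices of the form (K a, b ; M c, K d)

twist : Mat → ℤ → Mat
twist Y u = (upper (- (a Y * u)) · Y) · upper (- (d Y * u))

upper-sandwich-cancel : ∀ Y m n → (upper (- m) · ((upper m · Y) · upper n)) · upper (- n) ≡ Y
upper-sandwich-cancel Y m n = begin
  (upper (- m) · (Y′ · upper n)) · upper (- n) ≡⟨ ·-assoc (upper (- m)) (Y′ · upper n) (upper (- n)) ⟩
  upper (- m) · ((Y′ · upper n) · upper (- n)) ≡⟨ cong (upper (- m) ·_) (·-upper-cancel Y′ n (- n) (+-inverseʳ n)) ⟩
  upper (- m) · (upper m · Y)                  ≡⟨ ·-assoc (upper (- m)) (upper m) Y ⟨
  (upper (- m) · upper m) · Y                  ≡⟨ cong (_· Y) (trans (upper-+ (- m) m) (cong upper (+-inverseˡ m))) ⟩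
  I₂ · Y                                       ≡⟨ ·-identityˡ Y ⟩
  Y                                            ∎
  where
  open ≡-Reasoning
  Y′ = upper m · Y

Gen-untwist : ∀ {gens} → Gen gens T → ∀ Y u → Gen gens (twist Y u) → Gen gens Y
Gen-untwist genT Y u gen-twist =
  subst (Gen _) (upper-sandwich-cancel Y m n) (mul (mul (Gen-upper genT (- m)) gen-twist) (Gen-upper genT (- n)))
  where
  m = - (a Y * u)
  n = - (d Y * u)

det-twist : ∀ Y u → det Y ≡ + 1 → det (twist Y u) ≡ + 1
det-twist Y u det≡1 = det-·≡1 (upper m · Y) (upper n) (det-·≡1 (upper m) Y (det-upper m) det≡1) (det-upper n)
  where
  m = - (a Y * u)
  n = - (d Y * u)

-- The diagonal of twist Y u is (a (1 - u c), d (1 - u c)).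
twist-diagonal : ∀ K Y {u t} → u * c Y ≡ + 1 + K * t →
                 twist Y u ≡ mat (K * - (a Y * t)) (b (twist Y u)) (c Y) (K * - (d Y * t))
twist-diagonal K (mat a b C d) {u} {t} uC≡1+Kt =
  mat-cong (trans (entry-a a b C d u) (trans (cong (λ z → a - a * z) uC≡1+Kt) (factor a K t)))
           refl
           (entry-c a b C d u)
           (trans (entry-d a b C d u) (trans (cong (λ z → d - d * z) uC≡1+Kt) (factor d K t)))
  where
  entry-a : ∀ a b C d u → (+ 1 * a + - (a * u) * C) * + 1 + (+ 1 * b + - (a * u) * d) * + 0 ≡ a - a * (u * C)
  entry-a = solve-∀
  entry-c : ∀ a b C d u → (+ 0 * a + + 1 * C) * + 1 + (+ 0 * b + + 1 * d) * + 0 ≡ C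
  entry-c = solve-∀
  entry-d : ∀ a b C d u → (+ 0 * a + + 1 * C) * - (d * u) + (+ 0 * b + + 1 * d) * + 1 ≡ d - d * (u * C)
  entry-d = solve-∀
  factor : ∀ x K t → x - x * (+ 1 + K * t) ≡ K * - (x * t)
  factor = solve-∀

module KFormGenerators (M K : ℕ) .{{_ : ℕ.NonZero M}} .{{_ : ℕ.NonZero K}} (K⊥M : gcd K M ≡ 1) where
  open Schreier M

  KForm : Mat → Set
  KForm g = ∃ λ α → ∃ λ β → ∃ λ γ → ∃ λ δ → g ≡ mat (+ K * α) β (+ M * γ) (+ K * δ)

  InΓ₀-KForm : Mat → Set
  InΓ₀-KForm g = InΓ₀ (+ M) g × KForm g

  InΓ₀? : Decidable (InΓ₀ (+ M))
  InΓ₀? g = det g ≟ + 1 ×-dec (M ℕ.∣? ∣ c g ∣)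

  twist-InΓ₀-KForm : ∀ Y {u t} → u * c Y ≡ + 1 + + K * t → InΓ₀ (+ M) Y → InΓ₀-KForm (twist Y u)
  twist-InΓ₀-KForm Y {u} {t} uc≡1+Kt (det≡1 , M∣c) =
    (det-twist Y u det≡1 , subst (λ z → M ℕ.∣ ∣ z ∣) (sym (cong c shape)) M∣c) ,
    - (a Y * t) , b (twist Y u) , γ , - (d Y * t) ,
    trans shape (mat-cong refl refl (trans (_∣_.equality M∣cℤ) (*-comm γ (+ M))) refl)
    where
    shape = twist-diagonal (+ K) Y uc≡1+Kt
    M∣cℤ : + M ∣ c Y
    M∣cℤ = ∣ᵤ⇒∣ M∣c
    γ = quotient M∣cℤ

  shift : Mat → ℕ
  shift Y = coprimePart K ∣ c Y ∣

  shifted : Mat → Mat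
  shifted Y = Y · lower (+ M * + shift Y)

  shifted-coprime : ∀ Y → det Y ≡ + 1 → ℤ.Coprime (+ K) (c (shifted Y))
  shifted-coprime Y det≡1 =
    subst (ℤ.Coprime (+ K)) c-eq (coprime-+-coprimePart* K (c Y) (d Y * + M) common≡1)
    where
    k = shift Y
    c-eq : c Y + + k * (d Y * + M) ≡ c (shifted Y)
    c-eq = trans (cong (_+_ (c Y)) (rearrange (+ k) (d Y) (+ M))) (sym (c-·lower Y (+ M * + k)))
      where
      rearrange : ∀ k d m → k * (d * m) ≡ d * (m * k)
      rearrange = solve-∀
    common≡1 : ∀ {i} → i ℕ.∣ K → + i ∣ c Y → + i ∣ d Y * + M → i ≡ 1
    common≡1 {i} i∣K i∣c i∣dM = bottomRow-coprime Y det≡1 i∣c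
      (∣ᵤ⇒∣ (ℤ.coprime-divisor (+ i) (+ M) (d Y) i⊥M (∣⇒∣ᵤ (subst (+ i ∣_) (*-comm (d Y) (+ M)) i∣dM))))
      where
      i⊥M : ℕ.Coprime i M
      i⊥M (j∣i , j∣M) = ℕ.gcd≡1⇒coprime K⊥M (ℕ.∣-trans j∣i i∣K , j∣M)

  shifted-InΓ₀ : ∀ Y → InΓ₀ (+ M) Y → InΓ₀ (+ M) (shifted Y)
  shifted-InΓ₀ Y (det≡1 , M∣c) =
    det-·≡1 Y (lower x) det≡1 (det-lower x) ,
    ∣⇒∣ᵤ (subst (+ M ∣_) (sym (c-·lower Y x)) (∣m∣n⇒∣m+n (∣ᵤ⇒∣ {+ M} {c Y} M∣c) (∣n⇒∣m*n (d Y) M∣x)))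
    where
    x = + M * + shift Y
    M∣x : + M ∣ x
    M∣x = ∣m⇒∣m*n (+ shift Y) ∣-refl

  toKForm : Mat → Mat
  toKForm Y = twist (shifted Y) (invMod K (c (shifted Y)))

  toKForm-InΓ₀-KForm : ∀ Y → InΓ₀ (+ M) Y → InΓ₀-KForm (toKForm Y)
  toKForm-InΓ₀-KForm Y Y∈Γ₀ =
    twist-InΓ₀-KForm (shifted Y) (proj₂ (invMod-inverse K (c (shifted Y)) (shifted-coprime Y (proj₁ Y∈Γ₀))))
                     (shifted-InΓ₀ Y Y∈Γ₀)

  Gen-from-toKForm : ∀ {gens} → Gen gens T → Gen gens (lower (+ M)) → ∀ Y → Gen gens (toKForm Y) → Gen gens Y
  Gen-from-toKForm genT genL Y gen-toKForm =
    subst (Gen _) unshift (mul (Gen-untwist genT (shifted Y) _ gen-toKForm) (Gen-lower (+ M) genL (- + k)))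
    where
    k = shift Y
    unshift : shifted Y · lower (+ M * - + k) ≡ Y
    unshift = ·-lower-cancel Y (+ M * + k) (+ M * - + k)
                (trans (cong (_+_ (+ M * + k)) (sym (neg-distribʳ-* (+ M) (+ k)))) (+-inverseʳ (+ M * + k)))

  generators : List Mat
  generators = twist (lower (+ M)) (invMod K (+ M)) ∷ map toKForm (filter InΓ₀? schreierGenerators)

  generators-InΓ₀-KForm : All InΓ₀-KForm generators
  generators-InΓ₀-KForm =
    twist-InΓ₀-KForm (lower (+ M)) (proj₂ (invMod-inverse K (+ M) (ℕ.gcd≡1⇒coprime K⊥M)))
                     (det-lower (+ M) , ℕ.∣-refl) ∷
    All.map⁺ (All.map (λ {Y} → toKForm-InΓ₀-KForm Y) (All.all-filter InΓ₀? schreierGenerators))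

  Γ₀-generated-by-generators : ∀ g → InΓ₀ (+ M) g → Gen (T ∷ generators) g
  Γ₀-generated-by-generators = Γ₀-generated (T ∷ generators) gen-schreier
    where
    genT : Gen (T ∷ generators) T
    genT = gen (here refl)
    genL : Gen (T ∷ generators) (lower (+ M))
    genL = Gen-untwist genT (lower (+ M)) _ (gen (there (here refl)))
    gen-schreier : ∀ {Y} → Y ∈ schreierGenerators → InΓ₀ (+ M) Y → Gen (T ∷ generators) Y
    gen-schreier {Y} Y∈ Y∈Γ₀ =
      Gen-from-toKForm genT genL Y (gen (there (there (∈-map⁺ toKForm (∈-filter⁺ InΓ₀? Y∈ Y∈Γ₀)))))

mainTheorem10 : (M K : ℕ) → M ≥ 1 → K > 1 → gcd K M ≡ 1 →
    Σ (List Mat) λ L →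
      All (λ g → InΓ₀ (+ M) g ×
                 ∃ λ a → ∃ λ b → ∃ λ c → ∃ λ d →
                   g ≡ mat (+ K * a) b (+ M * c) (+ K * d)) L
      × (∀ g → InΓ₀ (+ M) g → Gen (T ∷ L) g)
mainTheorem10 M K M≥1 K>1 K⊥M = generators , generators-InΓ₀-KForm , Γ₀-generated-by-generators
  where
  instance
    M≢0 : ℕ.NonZero M
    M≢0 = ℕ.>-nonZero M≥1
    -- K > 1 is only needed for K ≢ 0.
    K≢0 : ℕ.NonZero K
    K≢0 = ℕ.>-nonZero (ℕ.<-trans (ℕ.s≤s ℕ.z≤n) K>1)
  open KFormGenerators M K K⊥M
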